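{- Let $H$ be a connected graph of order $n\geqslant 3$. Then $D'(K_1\circ H)\leqslant D'(H)+1$.
   Context: $K_1$ is the single-vertex graph; $K_1\circ H$ is the corona, i.e. $H$ together with one new vertex adjacent to every vertex of $H$ (in general $G\circ H$ takes one copy of $G$ and $|V(G)|$ copies of $H$ and joins the $i$-th vertex of $G$ to every vertex of the $i$-th copy of $H$). The distinguishing index $D'(G)$ is the least $d$ such that some edge colouring $E(G)\to\{1,\dots,d\}$ (not necessarily proper) is preserved by no non-identity automorphism of $G$ (acting on edges). -}

module Defs where

open import Data.Nat using (ℕ; zero; suc; _≤_)
open import Data.Fin using (Fin; zero; suc)
open import Data.Bool using (Bool; true; false)
open import Data.Product using (Σ; ∃; _×_; _,_)
open import Data.Fin.Permutation using (Permutation′; _⟨$⟩ʳ_)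
open import Relation.Binary.PropositionalEquality using (_≡_)

record Graph (n : ℕ) : Set where
  field
    adj    : Fin n → Fin n → Bool
    sym    : ∀ i j → adj i j ≡ adj j i
    irrefl : ∀ i → adj i i ≡ false
open Graph public

data Reach {n : ℕ} (G : Graph n) : Fin n → Fin n → Set where
  here : ∀ {i} → Reach G i i
  step : ∀ {i j k} → adj G i j ≡ true → Reach G j k → Reach G i k

Connected : ∀ {n} → Graph n → Set
Connected G = ∀ i j → Reach G i j

-- The corona K₁ ∘ H: vertex zero is the new vertex, adjacent to every
-- vertex suc i of the copy of H.
coronaAdj : ∀ {n} → Graph n → Fin (suc n) → Fin (suc n) → Bool
coronaAdj H zero    zero    = false
coronaAdj H zero    (suc j) = true
coronaAdj H (suc i) zero    = true
coronaAdj H (suc i) (suc j) = adj H i j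

coronaSym : ∀ {n} (H : Graph n) i j → coronaAdj H i j ≡ coronaAdj H j i
coronaSym H zero    zero    = Relation.Binary.PropositionalEquality.refl
coronaSym H zero    (suc j) = Relation.Binary.PropositionalEquality.refl
coronaSym H (suc i) zero    = Relation.Binary.PropositionalEquality.refl
coronaSym H (suc i) (suc j) = sym H i j

coronaIrrefl : ∀ {n} (H : Graph n) i → coronaAdj H i i ≡ false
coronaIrrefl H zero    = Relation.Binary.PropositionalEquality.refl
coronaIrrefl H (suc i) = irrefl H i

K₁∘ : ∀ {n} → Graph n → Graph (suc n)
K₁∘ H = record { adj = coronaAdj H ; sym = coronaSym H ; irrefl = coronaIrrefl H }

IsAutomorphism : ∀ {n} → Graph n → Permutation′ n → Set
IsAutomorphism G σ = ∀ i j → adj G (σ ⟨$⟩ʳ i) (σ ⟨$⟩ʳ j) ≡ adj G i j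

-- An edge colouring with colours {1,…,d} (represented by Fin d):
-- a colour for each ordered pair, required to agree on both orientations
-- of every edge (values on non-edges are irrelevant).
record EdgeColouring {n : ℕ} (G : Graph n) (d : ℕ) : Set where
  field
    colour    : Fin n → Fin n → Fin d
    colourSym : ∀ i j → adj G i j ≡ true → colour i j ≡ colour j i
open EdgeColouring public

Preserves : ∀ {n d} {G : Graph n} → EdgeColouring G d → Permutation′ n → Set
Preserves {G = G} c σ =
  ∀ i j → adj G i j ≡ true → colour c (σ ⟨$⟩ʳ i) (σ ⟨$⟩ʳ j) ≡ colour c i j

Distinguishing : ∀ {n d} {G : Graph n} → EdgeColouring G d → Set
Distinguishing {G = G} c =
  ∀ σ → IsAutomorphism G σ → Preserves c σ → ∀ i → σ ⟨$⟩ʳ i ≡ i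

DistEdgeColourable : ∀ {n} → Graph n → ℕ → Set
DistEdgeColourable G d = Σ (EdgeColouring G d) Distinguishing

-- Colour each edge of H as before, shifted by one, and give every spoke of the
-- apex the new colour 0. The colour-0 edges are then exactly the spokes, so a
-- colour-preserving permutation sending the apex to a vertex x of H would send
-- two distinct spokes to spokes at x, both ending at the apex — impossible for
-- an injective map. Hence the apex is fixed, the permutation restricts to a
-- colour-preserving automorphism of H, and that is the identity.
module Submission where

open import Defs hiding (sym)
open import Data.Nat using (ℕ; suc; _≤_; s≤s)
open import Data.Fin using (Fin; zero; suc)
open import Data.Fin.Properties using (suc-injective)
open import Data.Fin.Permutation
  using (Permutation′; _⟨$⟩ʳ_; remove; lift₀-remove)
open import Data.Product using (_,_)
open import Data.Bool using (true)
open import Data.Empty using (⊥-elim)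
open import Function.Bundles using (Injection)
open import Function.Properties.Inverse using (↔⇒↣)
open import Relation.Binary.PropositionalEquality

module _ {n d : ℕ} {H : Graph n} (c : EdgeColouring H d) where

  coronaColour : Fin (suc n) → Fin (suc n) → Fin (suc d)
  coronaColour zero    _       = zero
  coronaColour (suc i) zero    = zero
  coronaColour (suc i) (suc j) = suc (colour c i j)

  coronaColourSym : ∀ i j → adj (K₁∘ H) i j ≡ true →
    coronaColour i j ≡ coronaColour j i
  coronaColourSym zero    (suc j) _ = refl
  coronaColourSym (suc i) zero    _ = refl
  coronaColourSym (suc i) (suc j) e = cong suc (colourSym c i j e)

  coronaColouring : EdgeColouring (K₁∘ H) (suc d)
  coronaColouring = record { colour = coronaColour ; colourSym = coronaColourSym }

  coronaColour-zero⇒apex : ∀ i j → coronaColour (suc i) j ≡ zero → j ≡ zero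
  coronaColour-zero⇒apex i zero _ = refl

  apex-fixed : ∀ {u v : Fin n} → u ≢ v → (σ : Permutation′ (suc n)) →
    Preserves coronaColouring σ → σ ⟨$⟩ʳ zero ≡ zero
  apex-fixed {u} {v} u≢v σ preserves with σ ⟨$⟩ʳ zero in σ-apex
  ... | zero  = refl
  ... | suc x = ⊥-elim (u≢v (suc-injective
                  (Injection.injective (↔⇒↣ σ) (trans (spoke↦apex u) (sym (spoke↦apex v))))))
    where
    spoke↦apex : ∀ w → σ ⟨$⟩ʳ suc w ≡ zero
    spoke↦apex w = coronaColour-zero⇒apex x (σ ⟨$⟩ʳ suc w)
      (subst (λ a → coronaColour a (σ ⟨$⟩ʳ suc w) ≡ zero) σ-apex
             (preserves zero (suc w) refl))

  module Restriction (σ : Permutation′ (suc n)) (σ-apex : σ ⟨$⟩ʳ zero ≡ zero) where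

    τ : Permutation′ n
    τ = remove zero σ

    σ-suc : ∀ i → σ ⟨$⟩ʳ suc i ≡ suc (τ ⟨$⟩ʳ i)
    σ-suc i = sym (lift₀-remove σ σ-apex (suc i))

    τ-automorphism : IsAutomorphism (K₁∘ H) σ → IsAutomorphism H τ
    τ-automorphism aut i j =
      trans (sym (cong₂ (adj (K₁∘ H)) (σ-suc i) (σ-suc j))) (aut (suc i) (suc j))

    τ-preserves : Preserves coronaColouring σ → Preserves c τ
    τ-preserves preserves i j e = suc-injective
      (trans (sym (cong₂ coronaColour (σ-suc i) (σ-suc j))) (preserves (suc i) (suc j) e))

  coronaColouring-distinguishing : ∀ {u v : Fin n} → u ≢ v →
    Distinguishing c → Distinguishing coronaColouring
  coronaColouring-distinguishing u≢v dist σ aut preserves = fixes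
    where
    σ-apex : σ ⟨$⟩ʳ zero ≡ zero
    σ-apex = apex-fixed u≢v σ preserves

    open Restriction σ σ-apex

    fixes : ∀ i → σ ⟨$⟩ʳ i ≡ i
    fixes zero    = σ-apex
    fixes (suc i) = trans (σ-suc i)
      (cong suc (dist τ (τ-automorphism aut) (τ-preserves preserves) i))

mainTheorem14 : ∀ {n} (H : Graph n) → 3 ≤ n → Connected H →
    ∀ d → DistEdgeColourable H d → DistEdgeColourable (K₁∘ H) (suc d)
mainTheorem14 H (s≤s (s≤s (s≤s _))) _ d (c , dist) =
  coronaColouring c , coronaColouring-distinguishing c zero≢one dist
  where
  zero≢one : zero ≢ suc zero
  zero≢one ()
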